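{- Let $\mathcal M=(U,\mathcal L)$ be a (simple) complex of oriented matroids of VC-dimension $d$, and let $\mathcal T\subseteq\{ -1,+1\}^U$ be its set of topes. Then the concept class $\mathcal T$ admits a proper labeled sample compression scheme of size $d$.
   Context: Let $U$ be a finite set. A sign vector is a map $X:U\to\{ -1,0,+1\}$; its support is $\underline{X}=\{e\in U:X_e\neq 0\}$ and its zero set is $X^0=U\setminus \underline{X}$. For sign vectors $X,Y$: $\mathrm{Sep}(X,Y)=\{e\in U: X_eY_e=-1\}$; the composition $X\circ Y$ is defined by $(X\circ Y)_e=X_e$ if $X_e\neq 0$ and $(X\circ Y)_e=Y_e$ otherwise; $X\le Y$ means $X_e\in\{0,Y_e\}$ for all $e$ (product order with $0\le -1,+1$). A complex of oriented matroids (COM) is a pair $\mathcal M=(U,\mathcal L)$ with $\mathcal L\subseteq\{ -1,0,+1\}^U$ satisfying (FS) $X\circ(-Y)\in\mathcal L$ for all $X,Y\in\mathcal L$, and (SE) for all $X,Y\in\mathcal L$ and $e\in \mathrm{Sep}(X,Y)$ there is $Z\in\mathcal L$ with $Z_e=0$ and $Z_f=(X\circ Y)_f$ for all $f\in U\setminus\mathrm{Sep}(X,Y)$. The COM is simple if for each $e$, $\{X_e:X\in\mathcal L\}=\{ -1,0,+1\}$, and for all $e\ne f$ there are $X,Y\in\mathcal L$ with $\{X_eX_f,Y_eY_f\}=\{+1,-1\}$. The topes are the maximal elements of $(\mathcal L,\le)$ (these are $\{\pm1\}$-vectors, identified with subsets of $U$). A set $D\subseteq U$ is shattered by the topes if for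 every $Z\in\{\pm1\}^D$ some tope restricts to $Z$ on $D$; the VC-dimension of $\mathcal M$ is the maximum size of a shattered set. For a concept class $\mathcal C\subseteq\{ -1,+1\}^U$, the set of realizable samples is $\mathrm{Samp}(\mathcal C)=\{S\in\{ -1,0,+1\}^U: S\le C \text{ for some } C\in\mathcal C\}$. A proper labeled sample compression scheme of size $k$ for $\mathcal C$ is a pair of maps $\alpha:\mathrm{Samp}(\mathcal C)\to\{ -1,0,+1\}^U$ and $\beta:\mathrm{Im}(\alpha)\to\{ -1,+1\}^U$ such that for every $S\in\mathrm{Samp}(\mathcal C)$: $\alpha(S)\le S\le \beta(\alpha(S))$, $|\underline{\alpha(S)}|\le k$, and $\beta(\alpha(S))\in\mathcal C$. -}

module Defs where

open import Data.Nat using (ℕ; zero; suc; _≤_)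
open import Data.Fin using (Fin)
open import Data.Vec using (Vec; lookup; zipWith; map; count)
open import Data.Bool using (Bool; true; false; T?)
open import Data.List using (List)
open import Data.List.Membership.Propositional using (_∈_)
open import Data.Product using (Σ; ∃; _×_; _,_)
open import Data.Fin.Subset using (Subset; ∣_∣) renaming (_∈_ to _∈ₛ_)
open import Relation.Binary.PropositionalEquality using (_≡_; _≢_)
open import Relation.Nullary using (¬_; Dec; yes; no)

data Sign : Set where
  - : Sign
  𝟘 : Sign
  + : Sign

neg : Sign → Sign
neg - = +
neg 𝟘 = 𝟘
neg + = -

_·_ : Sign → Sign → Sign
𝟘 · _ = 𝟘
_ · 𝟘 = 𝟘
+ · + = +
- · - = +
+ · - = -
- · + = -

SV : ℕ → Set
SV n = Vec Sign n

_∘ₛ_ : Sign → Sign → Sign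
𝟘 ∘ₛ y = y
- ∘ₛ _ = -
+ ∘ₛ _ = +

_∘_ : ∀ {n} → SV n → SV n → SV n
X ∘ Y = zipWith _∘ₛ_ X Y

negV : ∀ {n} → SV n → SV n
negV = map neg

InSep : ∀ {n} → SV n → SV n → Fin n → Set
InSep X Y e = lookup X e · lookup Y e ≡ -

data _≤ₛ_ : Sign → Sign → Set where
  0≤ : ∀ {s} → 𝟘 ≤ₛ s
  refl≤ : ∀ {s} → s ≤ₛ s

_≼_ : ∀ {n} → SV n → SV n → Set
X ≼ Y = ∀ e → lookup X e ≤ₛ lookup Y e

nonzero? : Sign → Bool
nonzero? 𝟘 = false
nonzero? _ = true

supportSize : ∀ {n} → SV n → ℕ
supportSize X = count (λ s → T? (nonzero? s)) X

FS : ∀ {n} → List (SV n) → Set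
FS L = ∀ {X Y} → X ∈ L → Y ∈ L → (X ∘ negV Y) ∈ L

SE : ∀ {n} → List (SV n) → Set
SE L = ∀ {X Y} → X ∈ L → Y ∈ L → ∀ e → InSep X Y e →
  ∃ λ Z → Z ∈ L × lookup Z e ≡ 𝟘 ×
    (∀ f → ¬ InSep X Y f → lookup Z f ≡ lookup (X ∘ Y) f)

IsCOM : ∀ {n} → List (SV n) → Set
IsCOM L = FS L × SE L

Simple : ∀ {n} → List (SV n) → Set
Simple {n} L =
  (∀ e → (∃ λ X → X ∈ L × lookup X e ≡ -)
       × (∃ λ X → X ∈ L × lookup X e ≡ 𝟘)
       × (∃ λ X → X ∈ L × lookup X e ≡ +))
  × (∀ e f → e ≢ f → ∃ λ X → ∃ λ Y → X ∈ L × Y ∈ L ×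
        lookup X e · lookup X f ≡ + × lookup Y e · lookup Y f ≡ -)

IsTope : ∀ {n} → List (SV n) → SV n → Set
IsTope L T = T ∈ L × (∀ {Y} → Y ∈ L → T ≼ Y → Y ≡ T)

-- a choice of labels Z ∈ {±1}^D, encoded by a subset (true ↦ +, false ↦ -)
toSign : Bool → Sign
toSign true = +
toSign false = -

Shattered : ∀ {n} → List (SV n) → Subset n → Set
Shattered {n} L D = (Z : Subset n) →
  ∃ λ T → IsTope L T × (∀ e → e ∈ₛ D → lookup T e ≡ toSign (lookup Z e))

VCdim : ∀ {n} → List (SV n) → ℕ → Set
VCdim {n} L d = (∃ λ D → Shattered L D × ∣ D ∣ ≡ d)
              × (∀ D → Shattered L D → ∣ D ∣ ≤ d)

Samp : ∀ {n} → (SV n → Set) → SV n → Set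
Samp C S = ∃ λ T → C T × S ≼ T

IsPlusMinus : ∀ {n} → SV n → Set
IsPlusMinus X = ∀ e → lookup X e ≢ 𝟘

-- proper labeled sample compression scheme of size k for C.
-- α, β are given as total maps; only their behaviour on Samp(C)
-- (resp. Im(α|Samp(C))) is constrained.
ProperLSCS : ∀ {n} → (SV n → Set) → ℕ → Set
ProperLSCS {n} C k = Σ (SV n → SV n) λ α → Σ (SV n → SV n) λ β →
  ∀ S → Samp C S →
    α S ≼ S × S ≼ β (α S) × supportSize (α S) ≤ k
    × IsPlusMinus (β (α S)) × C (β (α S))

module Submission where

-- Induction on the ground set, removing its first element e. A realizable sample x ∷ S' is
-- compressed by compressing S' for the deletion L∖e (VC-dimension ≤ d) and reconstructed as a
-- tope of L extending the tope decoded there. That tope T covers x ∷ S' unless x ≠ 0 and T is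
-- separated at e from a tope R covering x ∷ S'; strong elimination of R and T then gives an
-- element of the contraction L/e above S'. In that case L has topes of both signs at e, so each
-- set shattered by L/e is shattered by L together with e: L/e has VC-dimension ≤ d − 1, and we
-- keep the label x and compress S' for L/e, reconstructing by composing (0 ∷ tope of L/e) with a
-- fixed tope of sign x at e. Topes are exactly the elements of maximal support, which is what
-- makes such compositions topes again.


open import Defs
open import Data.Nat using (ℕ; zero; suc; pred; _≤_; _<_; z≤n; s≤s)
open import Data.Nat.Base using (>-nonZero)
open import Data.Nat.Properties using (≤-trans; ≤-reflexive; <⇒≤pred; suc-pred)
open import Data.Fin using (zero; suc)
open import Data.Fin.Properties using (all?)
open import Data.Fin.Subset using (∣_∣; inside; outside; ⁅_⁆)
open import Data.Fin.Subset.Properties using (∉⊥; ∣⁅x⁆∣≡1)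
open import Data.Vec using ([]; _∷_; lookup; head; tail)
open import Data.Vec.Properties using (≡-dec; lookup-zipWith; lookup-map; tabulate∘lookup; tabulate-cong)
open import Data.Vec.Base using (here; there)
open import Data.Bool using (Bool; true; false)
open import Data.List using (List; []; _∷_; foldr; filter) renaming (map to mapₗ)
open import Data.List.Properties using (foldr-preservesʳ; foldr-preservesᵇ; foldr-preservesᵒ)
open import Data.List.Relation.Unary.Any as Any using (Any; any?)
open import Data.List.Relation.Unary.All as All using ()
open import Data.List.Membership.Propositional using (_∈_; find; lose)
open import Data.List.Membership.Propositional.Properties using (∈-map⁺; ∈-map⁻; ∈-filter⁺; ∈-filter⁻)
open import Data.Product using (∃; _×_; _,_; proj₁)
open import Data.Sum using (_⊎_; inj₁; inj₂)
open import Relation.Binary.Definitions using (Decidable; DecidableEquality)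
open import Relation.Binary.PropositionalEquality using (_≡_; _≢_; refl; sym; trans; cong; cong₂; subst; module ≡-Reasoning)
open import Relation.Nullary using (¬_; Dec; yes; no; contradiction; _×-dec_)

_≟ₛ_ : DecidableEquality Sign
- ≟ₛ - = yes refl
𝟘 ≟ₛ 𝟘 = yes refl
+ ≟ₛ + = yes refl
- ≟ₛ 𝟘 = no λ ()
- ≟ₛ + = no λ ()
𝟘 ≟ₛ - = no λ ()
𝟘 ≟ₛ + = no λ ()
+ ≟ₛ - = no λ ()
+ ≟ₛ 𝟘 = no λ ()

_≤ₛ?_ : Decidable _≤ₛ_
𝟘 ≤ₛ? y = yes 0≤
- ≤ₛ? - = yes refl≤
+ ≤ₛ? + = yes refl≤
- ≤ₛ? 𝟘 = no λ ()
- ≤ₛ? + = no λ ()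
+ ≤ₛ? 𝟘 = no λ ()
+ ≤ₛ? - = no λ ()

≤ₛ-trans : ∀ {x y z} → x ≤ₛ y → y ≤ₛ z → x ≤ₛ z
≤ₛ-trans 0≤ _ = 0≤
≤ₛ-trans refl≤ y≤z = y≤z

≤ₛ-∘ₛ : ∀ x y → x ≤ₛ (x ∘ₛ y)
≤ₛ-∘ₛ 𝟘 y = 0≤
≤ₛ-∘ₛ - y = refl≤
≤ₛ-∘ₛ + y = refl≤

≤ₛ-nonzero : ∀ {x y} → x ≤ₛ y → x ≢ 𝟘 → y ≡ x
≤ₛ-nonzero 0≤ x≢𝟘 = contradiction refl x≢𝟘
≤ₛ-nonzero refl≤ _ = refl

≤ₛ-sameZeros : ∀ {x y} → x ≤ₛ y → (x ≡ 𝟘 → y ≡ 𝟘) → y ≡ x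
≤ₛ-sameZeros 0≤ y≡𝟘 = y≡𝟘 refl
≤ₛ-sameZeros refl≤ _ = refl

∘ₛ≡𝟘⇒ˡ : ∀ x y → x ∘ₛ y ≡ 𝟘 → x ≡ 𝟘
∘ₛ≡𝟘⇒ˡ 𝟘 y _ = refl

∘ₛ≡𝟘⇒ʳ : ∀ x y → x ∘ₛ y ≡ 𝟘 → y ≡ 𝟘
∘ₛ≡𝟘⇒ʳ 𝟘 y eq = eq

∘ₛ-neg-∘ₛ-neg : ∀ x y → x ∘ₛ neg (x ∘ₛ neg y) ≡ x ∘ₛ y
∘ₛ-neg-∘ₛ-neg 𝟘 - = refl
∘ₛ-neg-∘ₛ-neg 𝟘 𝟘 = refl
∘ₛ-neg-∘ₛ-neg 𝟘 + = refl
∘ₛ-neg-∘ₛ-neg - y = refl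
∘ₛ-neg-∘ₛ-neg + y = refl

toSign-∘ₛ : ∀ b y → toSign b ∘ₛ y ≡ toSign b
toSign-∘ₛ true y = refl
toSign-∘ₛ false y = refl

-- On Sep(x, y) a sign below both x and y is 0.
≤ₛ-elimination : ∀ {s x y w} → s ≤ₛ x → s ≤ₛ y → (¬ x · y ≡ - → w ≡ x ∘ₛ y) → s ≤ₛ w
≤ₛ-elimination 0≤ _ _ = 0≤
≤ₛ-elimination refl≤ 0≤ _ = 0≤
≤ₛ-elimination {𝟘} refl≤ refl≤ _ = 0≤
≤ₛ-elimination { - } refl≤ refl≤ w≡ with w≡ (λ ())
... | refl = refl≤
≤ₛ-elimination {+} refl≤ refl≤ w≡ with w≡ (λ ())
... | refl = refl≤

≤ₛ⊎separated : ∀ x y → (y ≡ 𝟘 → x ≡ 𝟘) → x ≤ₛ y ⊎ x · y ≡ -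
≤ₛ⊎separated 𝟘 y _ = inj₁ 0≤
≤ₛ⊎separated - - _ = inj₁ refl≤
≤ₛ⊎separated + + _ = inj₁ refl≤
≤ₛ⊎separated - + _ = inj₂ refl
≤ₛ⊎separated + - _ = inj₂ refl
≤ₛ⊎separated - 𝟘 x≡𝟘 with x≡𝟘 refl
... | ()
≤ₛ⊎separated + 𝟘 x≡𝟘 with x≡𝟘 refl
... | ()

separated-signs : ∀ x y → x · y ≡ - → (x ≡ + × y ≡ -) ⊎ (x ≡ - × y ≡ +)
separated-signs + - _ = inj₁ (refl , refl)
separated-signs - + _ = inj₂ (refl , refl)
separated-signs 𝟘 _ ()
separated-signs - 𝟘 ()
separated-signs - - ()
separated-signs + 𝟘 ()
separated-signs + + ()

_≟ᵥ_ : ∀ {n} → DecidableEquality (SV n)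
_≟ᵥ_ = ≡-dec _≟ₛ_

_≼?_ : ∀ {n} → Decidable (_≼_ {n})
X ≼? Y = all? λ e → lookup X e ≤ₛ? lookup Y e

lookup-∘ : ∀ {n} (X Y : SV n) e → lookup (X ∘ Y) e ≡ lookup X e ∘ₛ lookup Y e
lookup-∘ X Y e = lookup-zipWith _∘ₛ_ e X Y

lookup-ext : ∀ {n} {X Y : SV n} → (∀ e → lookup X e ≡ lookup Y e) → X ≡ Y
lookup-ext {X = X} {Y} eq =
  trans (sym (tabulate∘lookup X)) (trans (tabulate-cong eq) (tabulate∘lookup Y))

≼-trans : ∀ {n} {X Y Z : SV n} → X ≼ Y → Y ≼ Z → X ≼ Z
≼-trans X≼Y Y≼Z e = ≤ₛ-trans (X≼Y e) (Y≼Z e)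

≼-∘ : ∀ {n} (X Y : SV n) → X ≼ (X ∘ Y)
≼-∘ X Y e = subst (lookup X e ≤ₛ_) (sym (lookup-∘ X Y e)) (≤ₛ-∘ₛ (lookup X e) (lookup Y e))

≼-∷ : ∀ {n x y} {X Y : SV n} → x ≤ₛ y → X ≼ Y → (x ∷ X) ≼ (y ∷ Y)
≼-∷ x≤y _ zero = x≤y
≼-∷ _ X≼Y (suc e) = X≼Y e

≼-head∷tail : ∀ {n x} {X : SV n} {Y} → x ≤ₛ head Y → X ≼ tail Y → (x ∷ X) ≼ Y
≼-head∷tail {Y = _ ∷ _} = ≼-∷

≼-head : ∀ {n} {X Y : SV (suc n)} → X ≼ Y → head X ≤ₛ head Y
≼-head {X = _ ∷ _} {_ ∷ _} X≼Y = X≼Y zero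

≼-tail : ∀ {n} {X Y : SV (suc n)} → X ≼ Y → tail X ≼ tail Y
≼-tail {X = _ ∷ _} {_ ∷ _} X≼Y e = X≼Y (suc e)

∘-negV-∘-negV : ∀ {n} (X Y : SV n) → X ∘ negV (X ∘ negV Y) ≡ X ∘ Y
∘-negV-∘-negV [] [] = refl
∘-negV-∘-negV (x ∷ X) (y ∷ Y) = cong₂ _∷_ (∘ₛ-neg-∘ₛ-neg x y) (∘-negV-∘-negV X Y)

-- Containment of supports, supp W ⊆ supp V, stated on zero sets; a record so that W and V
-- can be inferred.
infix 4 _⊑_

record _⊑_ {n} (W V : SV n) : Set where
  constructor ⊑-intro
  field zero-⊑ : ∀ e → lookup V e ≡ 𝟘 → lookup W e ≡ 𝟘

open _⊑_

⊑-refl : ∀ {n} {W : SV n} → W ⊑ W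
⊑-refl = ⊑-intro λ e W≡𝟘 → W≡𝟘

⊑-∘ˡ : ∀ {n} {W V : SV n} Y → W ⊑ V → W ⊑ (V ∘ Y)
⊑-∘ˡ {V = V} Y W⊑V = ⊑-intro λ e VY≡𝟘 →
  zero-⊑ W⊑V e (∘ₛ≡𝟘⇒ˡ (lookup V e) _ (trans (sym (lookup-∘ V Y e)) VY≡𝟘))

⊑-∘ʳ : ∀ {n} {W Y : SV n} V → W ⊑ Y → W ⊑ (V ∘ Y)
⊑-∘ʳ {Y = Y} V W⊑Y = ⊑-intro λ e VY≡𝟘 →
  zero-⊑ W⊑Y e (∘ₛ≡𝟘⇒ʳ (lookup V e) _ (trans (sym (lookup-∘ V Y e)) VY≡𝟘))

∘-absorbs⇒⊑ : ∀ {n} {T W : SV n} → T ∘ W ≡ T → W ⊑ T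
∘-absorbs⇒⊑ {T = T} {W} TW≡T = ⊑-intro λ e T≡𝟘 → begin
  lookup W e              ≡⟨ cong (_∘ₛ lookup W e) (sym T≡𝟘) ⟩
  lookup T e ∘ₛ lookup W e ≡⟨ sym (lookup-∘ T W e) ⟩
  lookup (T ∘ W) e        ≡⟨ cong (λ V → lookup V e) TW≡T ⟩
  lookup T e              ≡⟨ T≡𝟘 ⟩
  𝟘                       ∎
  where open ≡-Reasoning

≼-⊑⇒≡ : ∀ {n} {T W : SV n} → T ≼ W → W ⊑ T → W ≡ T
≼-⊑⇒≡ T≼W W⊑T = lookup-ext λ e → ≤ₛ-sameZeros (T≼W e) (zero-⊑ W⊑T e)

maxSupport⇒tope : ∀ {n} {L : List (SV n)} {T} → T ∈ L → (∀ {W} → W ∈ L → W ⊑ T) → IsTope L T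
maxSupport⇒tope T∈L max = T∈L , λ W∈L T≼W → ≼-⊑⇒≡ T≼W (max W∈L)

saturate : ∀ {n} → List (SV n) → SV n → SV n
saturate L X = foldr (λ Y V → V ∘ Y) X L

≼-saturate : ∀ {n} (L : List (SV n)) {X} → X ≼ saturate L X
≼-saturate L {X} = foldr-preservesʳ {P = X ≼_}
  (λ Y {V} X≼V → ≼-trans {X = X} {V} {V ∘ Y} X≼V (≼-∘ V Y)) (λ _ → refl≤) L

module _ {n} {L : List (SV n)} (fs : FS L) where

  ∘-closed : ∀ {X Y} → X ∈ L → Y ∈ L → X ∘ Y ∈ L
  ∘-closed {X} {Y} X∈L Y∈L = subst (_∈ L) (∘-negV-∘-negV X Y) (fs X∈L (fs X∈L Y∈L))

  tope-maxSupport : ∀ {T W} → IsTope L T → W ∈ L → W ⊑ T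
  tope-maxSupport {T} {W} (T∈L , T-max) W∈L =
    ∘-absorbs⇒⊑ (T-max (∘-closed T∈L W∈L) (≼-∘ T W))

  tope-∘ : ∀ {Z T} → Z ∈ L → IsTope L T → IsTope L (Z ∘ T)
  tope-∘ {Z} Z∈L tT =
    maxSupport⇒tope (∘-closed Z∈L (proj₁ tT)) λ W∈L → ⊑-∘ʳ Z (tope-maxSupport tT W∈L)

  saturate-tope : ∀ {X} → X ∈ L → IsTope L (saturate L X)
  saturate-tope X∈L = maxSupport⇒tope
    (foldr-preservesᵇ {P = _∈ L} (λ Y∈L V∈L → ∘-closed V∈L Y∈L) X∈L (All.tabulate λ Y∈L → Y∈L))
    λ {W} W∈L → foldr-preservesᵒ {P = W ⊑_}
      (λ Y V → λ { (inj₁ W⊑Y) → ⊑-∘ʳ V W⊑Y ; (inj₂ W⊑V) → ⊑-∘ˡ Y W⊑V })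
      _ L (inj₂ (Any.map (λ { refl → ⊑-refl }) W∈L))

  below-element⇒sample : ∀ {S X} → X ∈ L → S ≼ X → Samp (IsTope L) S
  below-element⇒sample {S} {X} X∈L S≼X =
    saturate L X , saturate-tope X∈L , ≼-trans {X = S} {X} {saturate L X} S≼X (≼-saturate L)

Loopless : ∀ {n} → List (SV n) → Set
Loopless L = ∀ e → ∃ λ X → X ∈ L × lookup X e ≢ 𝟘

simple⇒loopless : ∀ {n} {L : List (SV n)} → Simple L → Loopless L
simple⇒loopless simple e with proj₁ (proj₁ simple e)
... | X , X∈L , Xe≡- = X , X∈L , λ Xe≡𝟘 → contradiction (trans (sym Xe≡-) Xe≡𝟘) λ ()

tope-plusMinus : ∀ {n} {L : List (SV n)} → FS L → Loopless L → ∀ {T} → IsTope L T → IsPlusMinus T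
tope-plusMinus fs loopless tT e Te≡𝟘 with loopless e
... | X , X∈L , Xe≢𝟘 = Xe≢𝟘 (zero-⊑ (tope-maxSupport fs tT X∈L) e Te≡𝟘)

elimination-above : ∀ {n} {L : List (SV n)} → SE L → ∀ {X Y S} → X ∈ L → Y ∈ L →
  ∀ e → InSep X Y e → S ≼ X → S ≼ Y → ∃ λ Z → Z ∈ L × lookup Z e ≡ 𝟘 × S ≼ Z
elimination-above se {X} {Y} X∈L Y∈L e sep S≼X S≼Y with se X∈L Y∈L e sep
... | Z , Z∈L , Ze≡𝟘 , Z≡X∘Y = Z , Z∈L , Ze≡𝟘 ,
  λ f → ≤ₛ-elimination (S≼X f) (S≼Y f) λ ¬sep → trans (Z≡X∘Y f ¬sep) (lookup-∘ X Y f)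

deletion : ∀ {n} → List (SV (suc n)) → List (SV n)
deletion = mapₗ tail

contraction : ∀ {n} → List (SV (suc n)) → List (SV n)
contraction L = deletion (filter (λ X → head X ≟ₛ 𝟘) L)

module _ {n} {L : List (SV (suc n))} where

  ∈-deletion⁺ : ∀ {X} → X ∈ L → tail X ∈ deletion L
  ∈-deletion⁺ = ∈-map⁺ tail

  ∈-deletion⁻ : ∀ {X'} → X' ∈ deletion L → ∃ λ x → (x ∷ X') ∈ L
  ∈-deletion⁻ X'∈ with ∈-map⁻ tail X'∈
  ... | x ∷ _ , X∈L , refl = x , X∈L

  ∈-contraction⁺ : ∀ {X'} → (𝟘 ∷ X') ∈ L → X' ∈ contraction L
  ∈-contraction⁺ X∈L = ∈-map⁺ tail (∈-filter⁺ (λ X → head X ≟ₛ 𝟘) {xs = L} X∈L refl)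

  ∈-contraction⁻ : ∀ {X'} → X' ∈ contraction L → (𝟘 ∷ X') ∈ L
  ∈-contraction⁻ {X'} X'∈ with ∈-map⁻ tail X'∈
  ... | _ ∷ _ , X∈filter , refl with ∈-filter⁻ (λ X → head X ≟ₛ 𝟘) {xs = L} X∈filter
  ...   | X∈L , refl = X∈L

  deletion-COM : IsCOM L → IsCOM (deletion L)
  deletion-COM (fs , se) = fs′ , se′
    where
    fs′ : FS (deletion L)
    fs′ X'∈ Y'∈ with ∈-deletion⁻ X'∈ | ∈-deletion⁻ Y'∈
    ... | _ , X∈L | _ , Y∈L = ∈-deletion⁺ (fs X∈L Y∈L)
    se′ : SE (deletion L)
    se′ X'∈ Y'∈ e sep with ∈-deletion⁻ X'∈ | ∈-deletion⁻ Y'∈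
    ... | _ , X∈L | _ , Y∈L with se X∈L Y∈L (suc e) sep
    ...   | _ ∷ Z' , Z∈L , Ze≡𝟘 , Z≡X∘Y = Z' , ∈-deletion⁺ Z∈L , Ze≡𝟘 , λ f → Z≡X∘Y (suc f)

  contraction-COM : IsCOM L → IsCOM (contraction L)
  contraction-COM (fs , se) = fs′ , se′
    where
    fs′ : FS (contraction L)
    fs′ X'∈ Y'∈ = ∈-contraction⁺ (fs (∈-contraction⁻ X'∈) (∈-contraction⁻ Y'∈))
    se′ : SE (contraction L)
    se′ X'∈ Y'∈ e sep with se (∈-contraction⁻ X'∈) (∈-contraction⁻ Y'∈) (suc e) sep
    ... | z ∷ Z' , Z∈L , Ze≡𝟘 , Z≡X∘Y with Z≡X∘Y zero (λ ())
    ...   | refl = Z' , ∈-contraction⁺ Z∈L , Ze≡𝟘 , λ f → Z≡X∘Y (suc f)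

  tope-deletion : FS L → ∀ {T} → IsTope L T → IsTope (deletion L) (tail T)
  tope-deletion fs {_ ∷ T'} tT = maxSupport⇒tope (∈-deletion⁺ (proj₁ tT)) max
    where
    max : ∀ {W'} → W' ∈ deletion L → W' ⊑ T'
    max W'∈ with ∈-deletion⁻ W'∈
    ... | _ , W∈L = ⊑-intro λ e → zero-⊑ (tope-maxSupport fs tT W∈L) (suc e)

-- A junk value when no element of L has tail T'.
extend : ∀ {n} → List (SV (suc n)) → SV n → SV (suc n)
extend L T' with any? (λ X → tail X ≟ᵥ T') L
... | yes found = saturate L (proj₁ (find found))
... | no _ = 𝟘 ∷ T'

extend-tope : ∀ {n} {L : List (SV (suc n))} → FS L → ∀ {T'} → IsTope (deletion L) T' →
  IsTope L (extend L T') × tail (extend L T') ≡ T'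
extend-tope {L = L} fs {T'} (T'∈ , T'-max) with any? (λ X → tail X ≟ᵥ T') L
... | yes found with find found
...   | X , X∈L , refl = saturate-tope fs X∈L ,
  T'-max (∈-deletion⁺ (proj₁ (saturate-tope fs X∈L))) (≼-tail {X = X} {saturate L X} (≼-saturate L))
extend-tope {L = L} fs (T'∈ , _) | no none with ∈-deletion⁻ T'∈
... | _ , X∈L = contradiction (lose X∈L refl) none

HasHead : ∀ {n} → List (SV (suc n)) → Sign → Set
HasHead L s = Any (λ X → head X ≡ s) L

TwoSided : ∀ {n} → List (SV (suc n)) → Set
TwoSided L = HasHead L + × HasHead L -

twoSided? : ∀ {n} (L : List (SV (suc n))) → Dec (TwoSided L)
twoSided? L = any? (λ X → head X ≟ₛ +) L ×-dec any? (λ X → head X ≟ₛ -) L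

module _ {n} {L : List (SV (suc n))} (fs : FS L) where

  tope-withHead : ∀ {s} → s ≢ 𝟘 → HasHead L s → ∃ λ T → IsTope L T × head T ≡ s
  tope-withHead s≢𝟘 has with find has
  ... | X , X∈L , refl = saturate L X , saturate-tope fs X∈L ,
    ≤ₛ-nonzero (≼-head {X = X} {saturate L X} (≼-saturate L)) s≢𝟘

  topesWithHeads : TwoSided L → ∀ b → ∃ λ T → IsTope L T × head T ≡ toSign b
  topesWithHeads (has+ , _) true = tope-withHead (λ ()) has+
  topesWithHeads (_ , has-) false = tope-withHead (λ ()) has-

  separated⇒twoSided : ∀ {X Y} → X ∈ L → Y ∈ L → InSep X Y zero → TwoSided L
  separated⇒twoSided {x ∷ _} {y ∷ _} X∈L Y∈L sep with separated-signs x y sep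
  ... | inj₁ (refl , refl) = lose X∈L refl , lose Y∈L refl
  ... | inj₂ (refl , refl) = lose Y∈L refl , lose X∈L refl

  shattered-deletion : ∀ {D'} → Shattered (deletion L) D' → Shattered L (outside ∷ D')
  shattered-deletion sh (_ ∷ Z') with sh Z'
  ... | T' , tT' , labels with extend L T' | extend-tope fs tT'
  ...   | t ∷ _ | tT , refl = t ∷ T' , tT , λ { zero () ; (suc e) (there e∈D') → labels e e∈D' }

  shattered-contraction : TwoSided L → ∀ {D'} →
    Shattered (contraction L) D' → Shattered L (inside ∷ D')
  shattered-contraction tw sh (b ∷ Z') with sh Z' | topesWithHeads tw b
  ... | Y , tY , labels | t ∷ T' , tT , refl =
    (𝟘 ∷ Y) ∘ (t ∷ T') , tope-∘ fs (∈-contraction⁻ (proj₁ tY)) tT ,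
    λ { zero here → refl
      ; (suc e) (there e∈D') → trans (lookup-∘ Y T' e)
          (trans (cong (_∘ₛ lookup T' e) (labels e e∈D')) (toSign-∘ₛ _ _)) }

  shattered-⁅zero⁆ : TwoSided L → Shattered L ⁅ zero ⁆
  shattered-⁅zero⁆ tw (b ∷ _) with topesWithHeads tw b
  ... | t ∷ T' , tT , refl =
    t ∷ T' , tT , λ { zero here → refl ; (suc e) (there e∈⊥) → contradiction e∈⊥ ∉⊥ }

VCdim≤ : ∀ {n} → List (SV n) → ℕ → Set
VCdim≤ L d = ∀ D → Shattered L D → ∣ D ∣ ≤ d

module _ {n} {L : List (SV (suc n))} {d} (fs : FS L) (bound : VCdim≤ L d) where

  VCdim≤-deletion : VCdim≤ (deletion L) d
  VCdim≤-deletion D' sh = bound (outside ∷ D') (shattered-deletion fs sh)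

  VCdim≤-contraction : TwoSided L → VCdim≤ (contraction L) (pred d)
  VCdim≤-contraction tw D' sh = <⇒≤pred (bound (inside ∷ D') (shattered-contraction fs tw sh))

  twoSided⇒pred< : TwoSided L → pred d < d
  twoSided⇒pred< tw = ≤-reflexive (suc-pred d {{>-nonZero 0<d}})
    where
    0<d : 0 < d
    0<d = subst (_≤ d) (∣⁅x⁆∣≡1 {suc n} zero) (bound ⁅ zero ⁆ (shattered-⁅zero⁆ fs tw))

covers⊎contractionSample : ∀ {n} {L : List (SV (suc n))} → IsCOM L → ∀ {x S' R T} →
  IsTope L R → (x ∷ S') ≼ R → IsTope L T → S' ≼ tail T →
  (x ∷ S') ≼ T ⊎ (InSep R T zero × Any (S' ≼_) (contraction L))
covers⊎contractionSample (fs , se) {S' = S'} {r ∷ _} {t ∷ _} tR xS'≼R tT S'≼T'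
  with ≤ₛ⊎separated r t (zero-⊑ (tope-maxSupport fs tT (proj₁ tR)) zero)
... | inj₁ r≤t = inj₁ (≼-∷ (≤ₛ-trans (xS'≼R zero) r≤t) S'≼T')
... | inj₂ sep with elimination-above se {S = 𝟘 ∷ S'} (proj₁ tR) (proj₁ tT) zero sep
                      (≼-∷ 0≤ λ e → xS'≼R (suc e)) (≼-∷ 0≤ S'≼T')
...   | _ ∷ _ , Z∈L , refl , S≼Z = inj₂ (sep , lose (∈-contraction⁺ Z∈L) λ e → S≼Z (suc e))

-- ProperLSCS for the topes of L without the ±-condition, which is not inherited by deletions
-- and contractions.
Compresses : ∀ {n} → List (SV n) → ℕ → (S A B : SV n) → Set
Compresses L k S A B = A ≼ S × S ≼ B × supportSize A ≤ k × IsTope L B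

record TopeScheme {n} (L : List (SV n)) (k : ℕ) : Set where
  field
    compress reconstruct : SV n → SV n
    correct : ∀ S → Samp (IsTope L) S → Compresses L k S (compress S) (reconstruct (compress S))

topeScheme-zero : ∀ {L : List (SV 0)} {k} → TopeScheme L k
topeScheme-zero = record
  { compress = λ S → S
  ; reconstruct = λ A → A
  ; correct = λ { [] ([] , tT , _) → (λ ()) , (λ ()) , z≤n , tT }
  }

≼-𝟘∷-∘ : ∀ {n x} {X Y : SV n} T → head T ≡ x → X ≼ Y → (x ∷ X) ≼ ((𝟘 ∷ Y) ∘ T)
≼-𝟘∷-∘ {X = X} {Y} (_ ∷ T') refl X≼Y = ≼-∷ refl≤ (≼-trans {X = X} {Y} {Y ∘ T'} X≼Y (≼-∘ Y T'))

supportSize-toSign∷ : ∀ {n} b (A : SV n) → supportSize (toSign b ∷ A) ≡ suc (supportSize A)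
supportSize-toSign∷ true A = refl
supportSize-toSign∷ false A = refl

module Extension {m} {L : List (SV (suc m))} {d} (com : IsCOM L) (del : TopeScheme (deletion L) d) where
  open TopeScheme del renaming (compress to α′; reconstruct to β′; correct to correct′)

  fs : FS L
  fs = proj₁ com

  deletionTope : SV m → SV (suc m)
  deletionTope S' = extend L (β′ (α′ S'))

  deletionTope-tope : ∀ x S' → Samp (IsTope L) (x ∷ S') →
    (𝟘 ∷ α′ S') ≼ (x ∷ S') × supportSize (α′ S') ≤ d ×
    IsTope L (deletionTope S') × S' ≼ tail (deletionTope S')
  deletionTope-tope x S' (_ ∷ R' , tR , xS'≼R)
    with correct′ S' (R' , tope-deletion fs tR , λ e → xS'≼R (suc e))
  ... | α≼ , S'≼β , size , tβ with extend-tope fs tβ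
  ...   | tT , tail≡β = ≼-∷ 0≤ α≼ , size , tT , subst (S' ≼_) (sym tail≡β) S'≼β

  -- The deletion tope can only fail to cover x ∷ S' if it is separated at the first element
  -- from a tope covering x ∷ S'; strong elimination then puts S' below an element of the
  -- contraction.
  viaDeletion : ∀ x S' → Samp (IsTope L) (x ∷ S') →
    ¬ (x ≢ 𝟘 × TwoSided L × Any (S' ≼_) (contraction L)) →
    Compresses L d (x ∷ S') (𝟘 ∷ α′ S') (deletionTope S')
  viaDeletion x S' sample@(R , tR , xS'≼R) unlessContraction with deletionTope-tope x S' sample
  ... | α≼ , size , tT , S'≼T' = α≼ , covered , size , tT
    where
    covered : (x ∷ S') ≼ deletionTope S'
    covered with x ≟ₛ 𝟘
    ... | yes refl = ≼-head∷tail {Y = deletionTope S'} 0≤ S'≼T'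
    ... | no x≢𝟘 with covers⊎contractionSample com tR xS'≼R tT S'≼T'
    ...   | inj₁ xS'≼T = xS'≼T
    ...   | inj₂ (sep , z) =
      contradiction (x≢𝟘 , separated⇒twoSided fs (proj₁ tR) (proj₁ tT) sep , z) unlessContraction

  oneSided : ¬ TwoSided L → TopeScheme L d
  oneSided ¬tw = record
    { compress = λ S → 𝟘 ∷ α′ (tail S)
    ; reconstruct = λ A → extend L (β′ (tail A))
    ; correct = λ { (x ∷ S') sample → viaDeletion x S' sample λ (_ , tw , _) → ¬tw tw }
    }

  module WithContraction (tw : TwoSided L) {k} (con : TopeScheme (contraction L) k) (k<d : k < d) where
    open TopeScheme con renaming (compress to αᶜ; reconstruct to βᶜ; correct to correctᶜ)

    headTope : Bool → SV (suc m)
    headTope b = proj₁ (topesWithHeads fs tw b)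

    compress : SV (suc m) → SV (suc m)
    compress (𝟘 ∷ S') = 𝟘 ∷ α′ S'
    compress (x ∷ S') with any? (S' ≼?_) (contraction L)
    ... | yes _ = x ∷ αᶜ S'
    ... | no _ = 𝟘 ∷ α′ S'

    reconstruct : SV (suc m) → SV (suc m)
    reconstruct (𝟘 ∷ A') = extend L (β′ A')
    reconstruct (- ∷ A') = (𝟘 ∷ βᶜ A') ∘ headTope false
    reconstruct (+ ∷ A') = (𝟘 ∷ βᶜ A') ∘ headTope true

    viaContraction : ∀ b {S'} → Any (S' ≼_) (contraction L) →
      Compresses L d (toSign b ∷ S') (toSign b ∷ αᶜ S') ((𝟘 ∷ βᶜ (αᶜ S')) ∘ headTope b)
    viaContraction b {S'} z with find z
    ... | Z , Z∈ , S'≼Z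
      with correctᶜ S' (below-element⇒sample (proj₁ (contraction-COM com)) {S'} Z∈ S'≼Z)
    ...   | α≼ , S'≼β , size , tβ with topesWithHeads fs tw b
    ...     | T , tT , headT =
      ≼-∷ refl≤ α≼ ,
      ≼-𝟘∷-∘ T headT S'≼β ,
      subst (_≤ d) (sym (supportSize-toSign∷ b (αᶜ S'))) (≤-trans (s≤s size) k<d) ,
      tope-∘ fs (∈-contraction⁻ (proj₁ tβ)) tT

    correct : ∀ S → Samp (IsTope L) S → Compresses L d S (compress S) (reconstruct (compress S))
    correct (𝟘 ∷ S') sample = viaDeletion 𝟘 S' sample λ (𝟘≢𝟘 , _) → 𝟘≢𝟘 refl
    correct (+ ∷ S') sample with any? (S' ≼?_) (contraction L)
    ... | yes z = viaContraction true z
    ... | no ¬z = viaDeletion + S' sample λ (_ , _ , z) → ¬z z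
    correct (- ∷ S') sample with any? (S' ≼?_) (contraction L)
    ... | yes z = viaContraction false z
    ... | no ¬z = viaDeletion - S' sample λ (_ , _ , z) → ¬z z

    scheme : TopeScheme L d
    scheme = record { compress = compress ; reconstruct = reconstruct ; correct = correct }

topeScheme : ∀ n (L : List (SV n)) d → IsCOM L → VCdim≤ L d → TopeScheme L d
topeScheme zero L d com bound = topeScheme-zero
topeScheme (suc m) L d com@(fs , _) bound = extension (twoSided? L)
  where
  deletionScheme : TopeScheme (deletion L) d
  deletionScheme = topeScheme m (deletion L) d (deletion-COM com) (VCdim≤-deletion fs bound)
  extension : Dec (TwoSided L) → TopeScheme L d
  extension (no ¬tw) = Extension.oneSided com deletionScheme ¬tw
  extension (yes tw) = Extension.WithContraction.scheme com deletionScheme tw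
    (topeScheme m (contraction L) (pred d) (contraction-COM com) (VCdim≤-contraction fs bound tw))
    (twoSided⇒pred< fs bound tw)

theorem29 : (n : ℕ) (L : List (SV n)) (d : ℕ) →
    IsCOM L → Simple L → VCdim L d → ProperLSCS (IsTope L) d
theorem29 n L d com simple (_ , bound) = compress , reconstruct , λ S sample →
  let α≼ , S≼β , size , tβ = correct S sample
  in α≼ , S≼β , size , tope-plusMinus (proj₁ com) (simple⇒loopless simple) tβ , tβ
  where open TopeScheme (topeScheme n L d com bound)
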